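{- Let $G$ be a simple graph with vertices $v_1,\dots,v_n$, and let $B_G=(L_G+I_n)^{ -1}=[b_{ij}]$. Assume $v_j$ is a pendant vertex of $G$ (a vertex of degree $1$) whose unique neighbor is $v_k$. Then \[ b_{ik}=2\,b_{ij}\qquad (1\le i\le n,\ i\ne j). \]
   Context: $L_G=D-A$ is the Laplacian matrix of $G$ ($A$ adjacency matrix, $D$ diagonal matrix of degrees), with row/column $i$ corresponding to vertex $v_i$; $L_G+I_n$ is positive definite, hence invertible. -}

module Defs where

open import Data.Nat using (ℕ; zero; suc) renaming (_+_ to _ℕ+_)
open import Data.Fin using (Fin; zero; suc; _≟_)
open import Data.Bool using (Bool; true; false; if_then_else_)
open import Data.Rational using (ℚ; 0ℚ; 1ℚ; _+_; _*_; -_; _/_)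
open import Data.Integer using (+_)
open import Relation.Binary.PropositionalEquality using (_≡_)
open import Relation.Nullary using (yes; no; ¬_)
open import Data.Product using (_×_)

record SimpleGraph (n : ℕ) : Set where
  field
    adj   : Fin n → Fin n → Bool
    sym   : ∀ i j → adj i j ≡ adj j i
    loopless : ∀ i → adj i i ≡ false

open SimpleGraph public

Matrix : ℕ → Set
Matrix n = Fin n → Fin n → ℚ

Σ : ∀ {n} → (Fin n → ℚ) → ℚ
Σ {zero}  f = 0ℚ
Σ {suc n} f = f zero + Σ (λ i → f (suc i))

Σℕ : ∀ {n} → (Fin n → ℕ) → ℕ
Σℕ {zero}  f = 0
Σℕ {suc n} f = (f zero) ℕ+ (Σℕ (λ i → f (suc i)))

boolToℕ : Bool → ℕ
boolToℕ true  = 1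
boolToℕ false = 0

degree : ∀ {n} → SimpleGraph n → Fin n → ℕ
degree G i = Σℕ (λ j → boolToℕ (adj G i j))

I : ∀ {n} → Matrix n
I i j with i ≟ j
... | yes _ = 1ℚ
... | no  _ = 0ℚ

adjMatrix : ∀ {n} → SimpleGraph n → Matrix n
adjMatrix G i j = if adj G i j then 1ℚ else 0ℚ

degMatrix : ∀ {n} → SimpleGraph n → Matrix n
degMatrix G i j with i ≟ j
... | yes _ = (+ degree G i) / 1
... | no  _ = 0ℚ

_-ᴹ_ : ∀ {n} → Matrix n → Matrix n → Matrix n
(M -ᴹ N) i j = M i j + (- N i j)

_+ᴹ_ : ∀ {n} → Matrix n → Matrix n → Matrix n
(M +ᴹ N) i j = M i j + N i j

_*ᴹ_ : ∀ {n} → Matrix n → Matrix n → Matrix n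
(M *ᴹ N) i j = Σ (λ k → M i k * N k j)

laplacian : ∀ {n} → SimpleGraph n → Matrix n
laplacian G = degMatrix G -ᴹ adjMatrix G

IsInverse : ∀ {n} → Matrix n → Matrix n → Set
IsInverse M B = (∀ i j → (M *ᴹ B) i j ≡ I i j) × (∀ i j → (B *ᴹ M) i j ≡ I i j)

-- Column j of L_G + I has only two nonzero entries when v_j is pendant with
-- neighbour v_k: 2 on the diagonal and -1 in row k.  Reading off the (i, j)
-- entry of B (L_G + I) = I for i ≠ j therefore gives 2 b_ij - b_ik = 0.
module Submission where

open import Defs hiding (sym)
open import Data.Nat using (ℕ; zero; suc; _≤_; s≤s) renaming (_+_ to _ℕ+_)
open import Data.Nat.Properties using (≤-trans; m≤m+n; m≤n+m; +-comm; +-monoʳ-≤)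
open import Data.Fin using (Fin; zero; suc; _≟_)
open import Data.Fin.Properties using (suc-injective)
open import Data.Bool using (true; false)
open import Data.Rational using (ℚ; 0ℚ; 1ℚ; _+_; _*_; -_; _/_)
open import Data.Rational.Properties using (+-identityˡ; +-identityʳ; *-zeroʳ)
import Data.Rational.Properties as ℚᴾ
open import Data.Rational.Solver using (module +-*-Solver)
open import Data.Integer using (+_)
open import Data.Product using (_,_)
open import Data.Empty using (⊥-elim)
open import Function using (_∘_)
open import Relation.Binary.PropositionalEquality
open import Relation.Nullary using (¬_; yes; no)

Σ-zero : ∀ {n} (f : Fin n → ℚ) → (∀ l → f l ≡ 0ℚ) → Σ f ≡ 0ℚ
Σ-zero {zero}  f f≡0 = refl
Σ-zero {suc n} f f≡0 rewrite f≡0 zero | Σ-zero (f ∘ suc) (f≡0 ∘ suc) = refl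

Σ-single : ∀ {n} (f : Fin n → ℚ) (a : Fin n) →
           (∀ l → l ≢ a → f l ≡ 0ℚ) → Σ f ≡ f a
Σ-single f zero f≡0
  rewrite Σ-zero (f ∘ suc) (λ l → f≡0 (suc l) λ ()) = +-identityʳ (f zero)
Σ-single f (suc a) f≡0
  rewrite f≡0 zero (λ ())
        | Σ-single (f ∘ suc) a (λ l l≢a → f≡0 (suc l) (l≢a ∘ suc-injective))
  = +-identityˡ (f (suc a))

Σ-pair : ∀ {n} (f : Fin n → ℚ) (a b : Fin n) → a ≢ b →
         (∀ l → l ≢ a → l ≢ b → f l ≡ 0ℚ) → Σ f ≡ f a + f b
Σ-pair f zero zero a≢b f≡0 = ⊥-elim (a≢b refl)
Σ-pair f zero (suc b) a≢b f≡0
  rewrite Σ-single (f ∘ suc) b (λ l l≢b → f≡0 (suc l) (λ ()) (l≢b ∘ suc-injective))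
  = refl
Σ-pair f (suc a) zero a≢b f≡0
  rewrite Σ-single (f ∘ suc) a (λ l l≢a → f≡0 (suc l) (l≢a ∘ suc-injective) (λ ()))
  = ℚᴾ.+-comm (f zero) (f (suc a))
Σ-pair f (suc a) (suc b) a≢b f≡0
  rewrite f≡0 zero (λ ()) (λ ())
        | Σ-pair (f ∘ suc) a b (a≢b ∘ cong suc)
            (λ l l≢a l≢b → f≡0 (suc l) (l≢a ∘ suc-injective) (l≢b ∘ suc-injective))
  = +-identityˡ _

Σℕ-single-≤ : ∀ {n} (f : Fin n → ℕ) (a : Fin n) → f a ≤ Σℕ f
Σℕ-single-≤ f zero    = m≤m+n (f zero) _
Σℕ-single-≤ f (suc a) = ≤-trans (Σℕ-single-≤ (f ∘ suc) a) (m≤n+m _ (f zero))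

Σℕ-pair-≤ : ∀ {n} (f : Fin n → ℕ) (a b : Fin n) → a ≢ b → f a ℕ+ f b ≤ Σℕ f
Σℕ-pair-≤ f zero    zero    a≢b = ⊥-elim (a≢b refl)
Σℕ-pair-≤ f zero    (suc b) a≢b = +-monoʳ-≤ (f zero) (Σℕ-single-≤ (f ∘ suc) b)
Σℕ-pair-≤ f (suc a) zero    a≢b =
  subst (_≤ Σℕ f) (+-comm (f zero) (f (suc a)))
        (+-monoʳ-≤ (f zero) (Σℕ-single-≤ (f ∘ suc) a))
Σℕ-pair-≤ f (suc a) (suc b) a≢b =
  ≤-trans (Σℕ-pair-≤ (f ∘ suc) a b (a≢b ∘ cong suc)) (m≤n+m _ (f zero))

x*c-y≡0⇒y≡c*x : ∀ x y c → x * c + y * (- 1ℚ) ≡ 0ℚ → y ≡ c * x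
x*c-y≡0⇒y≡c*x x y c x*c-y≡0 = begin
    y
  ≡⟨ solve 3 (λ x y c → y := c :* x :+ (x :* c :+ y :* con (- 1ℚ)) :* con (- 1ℚ)) refl x y c ⟩
    c * x + (x * c + y * (- 1ℚ)) * (- 1ℚ)
  ≡⟨ cong (λ z → c * x + z * (- 1ℚ)) x*c-y≡0 ⟩
    c * x + 0ℚ * (- 1ℚ)
  ≡⟨ +-identityʳ (c * x) ⟩
    c * x ∎
  where open ≡-Reasoning
        open +-*-Solver

*ᴹ-column-pair : ∀ {n} (B N : Matrix n) (i j a b : Fin n) → a ≢ b →
                 (∀ l → l ≢ a → l ≢ b → N l j ≡ 0ℚ) →
                 (B *ᴹ N) i j ≡ B i a * N a j + B i b * N b j
*ᴹ-column-pair B N i j a b a≢b N≡0 =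
  Σ-pair (λ l → B i l * N l j) a b a≢b
    (λ l l≢a l≢b → trans (cong (B i l *_) (N≡0 l l≢a l≢b)) (*-zeroʳ (B i l)))

I-diagonal : ∀ {n} (i : Fin n) → I i i ≡ 1ℚ
I-diagonal i with i ≟ i
... | yes _   = refl
... | no i≢i = ⊥-elim (i≢i refl)

I-off-diagonal : ∀ {n} {i j : Fin n} → i ≢ j → I i j ≡ 0ℚ
I-off-diagonal {i = i} {j} i≢j with i ≟ j
... | yes i≡j = ⊥-elim (i≢j i≡j)
... | no _    = refl

module _ {n : ℕ} (G : SimpleGraph n) where

  adjacent⇒≢ : ∀ {i j} → adj G i j ≡ true → i ≢ j
  adjacent⇒≢ {i} i~i refl with trans (sym i~i) (loopless G i)
  ... | ()

  pendant-non-neighbour : ∀ {j k l} → degree G j ≡ 1 → adj G j k ≡ true →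
                          l ≢ k → adj G j l ≡ false
  pendant-non-neighbour {j} {k} {l} deg≡1 j~k l≢k =
    at-most-one (subst (λ b → boolToℕ b ℕ+ boolToℕ (adj G j l) ≤ 1) j~k
                  (subst (_ ≤_) deg≡1
                    (Σℕ-pair-≤ (λ m → boolToℕ (adj G j m)) k l (l≢k ∘ sym))))
    where
    at-most-one : ∀ {b} → 1 ℕ+ boolToℕ b ≤ 1 → b ≡ false
    at-most-one {false} _       = refl
    at-most-one {true}  (s≤s ())

  degMatrix-diagonal : ∀ i → degMatrix G i i ≡ (+ degree G i) / 1
  degMatrix-diagonal i with i ≟ i
  ... | yes _   = refl
  ... | no i≢i = ⊥-elim (i≢i refl)

  degMatrix-off-diagonal : ∀ {i j} → i ≢ j → degMatrix G i j ≡ 0ℚ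
  degMatrix-off-diagonal {i} {j} i≢j with i ≟ j
  ... | yes i≡j = ⊥-elim (i≢j i≡j)
  ... | no _    = refl

  laplacian+I-diagonal : ∀ i → (laplacian G +ᴹ I) i i ≡ (+ degree G i) / 1 + 1ℚ
  laplacian+I-diagonal i
    rewrite degMatrix-diagonal i | loopless G i | I-diagonal i
    = cong (_+ 1ℚ) (+-identityʳ ((+ degree G i) / 1))

  laplacian+I-adjacent : ∀ {i j} → adj G i j ≡ true → (laplacian G +ᴹ I) i j ≡ - 1ℚ
  laplacian+I-adjacent {i} {j} i~j
    rewrite degMatrix-off-diagonal (adjacent⇒≢ i~j) | I-off-diagonal (adjacent⇒≢ i~j) | i~j
    = refl

  laplacian+I-non-adjacent : ∀ {i j} → i ≢ j → adj G i j ≡ false →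
                             (laplacian G +ᴹ I) i j ≡ 0ℚ
  laplacian+I-non-adjacent i≢j i≁j
    rewrite degMatrix-off-diagonal i≢j | I-off-diagonal i≢j | i≁j
    = refl

lemma3p1 : ∀ {n : ℕ} (G : SimpleGraph n) (B : Matrix n) →
    IsInverse (laplacian G +ᴹ I) B →
    (j k : Fin n) → degree G j ≡ 1 → adj G j k ≡ true →
    (i : Fin n) → ¬ (i ≡ j) →
    B i k ≡ ((+ 2) / 1) * B i j
lemma3p1 {n} G B (_ , B*M≡I) j k deg≡1 j~k i i≢j =
  x*c-y≡0⇒y≡c*x (B i j) (B i k) ((+ 2) / 1) (begin
    B i j * ((+ 2) / 1) + B i k * (- 1ℚ)
      ≡⟨ sym (cong₂ (λ u v → B i j * u + B i k * v)
               (trans (laplacian+I-diagonal G j) (cong (λ d → (+ d) / 1 + 1ℚ) deg≡1))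
               (laplacian+I-adjacent G (trans (SimpleGraph.sym G k j) j~k))) ⟩
    B i j * M j j + B i k * M k j
      ≡⟨ sym (*ᴹ-column-pair B M i j j k (adjacent⇒≢ G j~k) column-j-vanishes) ⟩
    (B *ᴹ M) i j
      ≡⟨ B*M≡I i j ⟩
    I i j
      ≡⟨ I-off-diagonal i≢j ⟩
    0ℚ ∎)
  where
  open ≡-Reasoning
  M : Matrix n
  M = laplacian G +ᴹ I
  column-j-vanishes : ∀ l → l ≢ j → l ≢ k → M l j ≡ 0ℚ
  column-j-vanishes l l≢j l≢k =
    laplacian+I-non-adjacent G l≢j
      (trans (SimpleGraph.sym G l j) (pendant-non-neighbour G deg≡1 j~k l≢k))
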